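{- Let $M$ be a matching on $[2n]$ whose $n$ edges can be ordered as $p_1,p_2,\dots,p_n$ so that for each $2\le i\le n$, the edge $p_i$ has exactly one endpoint in the shadow of $\{p_1,\dots,p_{i-1}\}$ (i.e., $M$ is a pin sequence). Then $M$ is indecomposable.
   Context: A matching is a graph on the vertex set $[2n]=\{1,\dots,2n\}$ in which every vertex is incident to exactly one edge. An interval of a matching is a contiguous segment $[i,j]$ of vertices such that no vertex of $[i,j]$ is adjacent to a vertex outside $[i,j]$; the empty set and $[2n]$ are the trivial intervals, and the matching is indecomposable if it has no other intervals. The shadow of a set of edges is the smallest contiguous segment of vertices containing all their endpoints. -}

module Defs where

open import Data.Nat using (ℕ; zero; suc; _*_)
open import Data.Fin using (Fin; toℕ; _≤_; _<_)
open import Data.Product using (Σ; ∃; _×_; _,_)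
open import Data.Sum using (_⊎_)
open import Relation.Nullary using (¬_)
open import Relation.Binary.PropositionalEquality using (_≡_; _≢_)

-- Vertices of [2n] are Fin (2 * n) (vertex k+1 of the paper is the element k).
Vertex : ℕ → Set
Vertex n = Fin (2 * n)

-- A matching on [2n]: every vertex is incident to exactly one edge, i.e. the
-- adjacency is given by a fixed-point-free involution (the partner map).
record Matching (n : ℕ) : Set where
  field
    partner     : Vertex n → Vertex n
    involutive  : ∀ v → partner (partner v) ≡ v
    noFixed     : ∀ v → partner v ≢ v
open Matching public

Adj : ∀ {n} → Matching n → Vertex n → Vertex n → Set
Adj M u v = partner M u ≡ v

IsInterval : ∀ {n} → Matching n → Vertex n → Vertex n → Set
IsInterval {n} M i j =
  i ≤ j × (∀ (u v : Vertex n) → i ≤ u → u ≤ j → Adj M u v → i ≤ v × v ≤ j)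

Indecomposable : ∀ {n} → Matching n → Set
Indecomposable {n} M =
  ∀ (i j : Vertex n) → IsInterval M i j → toℕ i ≡ 0 × suc (toℕ j) ≡ 2 * n

-- An edge ordering p₁,…,pₙ: the i-th edge is {e i, partner M (e i)}, where
-- e i is its smaller endpoint; every edge of M occurs exactly once.
record EdgeOrder {n} (M : Matching n) : Set where
  field
    low      : Fin n → Vertex n
    lowIsLow : ∀ i → low i < partner M (low i)
    distinct : ∀ i j → low i ≡ low j → i ≡ j
    covers   : ∀ (v : Vertex n) → ∃ λ i → v ≡ low i ⊎ v ≡ partner M (low i)
open EdgeOrder public

Endpoint : ∀ {n} {M : Matching n} → EdgeOrder M → Fin n → Vertex n → Set
Endpoint {M = M} P i v = v ≡ low P i ⊎ v ≡ partner M (low P i)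

-- v lies in the shadow of {p_j : j < i} (the smallest contiguous segment
-- containing all their endpoints): some such endpoint is ≤ v and some is ≥ v.
InShadowBefore : ∀ {n} {M : Matching n} → EdgeOrder M → Fin n → Vertex n → Set
InShadowBefore {n} P i v =
  (Σ (Fin n) λ j → j < i × Σ (Vertex n) λ a → Endpoint P j a × a ≤ v) ×
  (Σ (Fin n) λ j → j < i × Σ (Vertex n) λ b → Endpoint P j b × v ≤ b)

-- Pin sequence condition: for each edge p_i with i ≥ 2 (0-based: toℕ i ≥ 1),
-- exactly one endpoint of p_i lies in the shadow of p_1,…,p_{i-1}.
IsPinOrder : ∀ {n} {M : Matching n} → EdgeOrder M → Set
IsPinOrder {n} {M} P =
  ∀ (i : Fin n) → 1 Data.Nat.≤ toℕ i →
    (InShadowBefore P i (low P i) × ¬ InShadowBefore P i (partner M (low P i)))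
    ⊎ (¬ InShadowBefore P i (low P i) × InShadowBefore P i (partner M (low P i)))

IsPinSequence : ∀ {n} → Matching n → Set
IsPinSequence M = Σ (EdgeOrder M) IsPinOrder

module Submission where

-- Let [i , j] be a nonempty interval of M.  Because no edge leaves it, every
-- edge of M lies either entirely inside or entirely outside [i , j].  Along a
-- pin order p₁,…,pₙ the side of each edge is forced by the earlier ones:
--   * if all earlier edges are inside, their shadow is inside the (convex)
--     segment [i , j]; the endpoint of pₖ in that shadow is inside, hence pₖ is;
--   * if all earlier edges are outside but pₖ were inside, the shadow would
--     straddle [i , j] (its ends lie outside, one of its points inside), so
--     both endpoints of pₖ would be in the shadow — contradicting the pin rule.
-- By strong induction on the pin order, all edges share the side of p₁.  They
-- cannot all be outside (the vertex i is inside), so all of [2n] is inside,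
-- i.e. i is the first and j the last vertex.

open import Data.Nat using (ℕ; zero; suc; z≤n; s≤s)
import Data.Nat as ℕ
open import Data.Nat.Properties using (n≤0⇒n≡0; ≰⇒>; <⇒≤; ≤-antisym)
open import Data.Fin using (Fin; toℕ; fromℕ; _≤_; _<_; _≤?_)
open import Data.Fin.Properties using (≤-trans; ≤-refl; ≤fromℕ; toℕ-fromℕ)
open import Data.Fin.Induction using (<-wellFounded)
open import Induction.WellFounded using (module All)
open import Data.Product using (_×_; _,_; proj₁; proj₂)
open import Data.Sum using (inj₁; inj₂)
open import Data.Empty using (⊥-elim)
open import Relation.Nullary using (¬_; Dec; yes; no)
open import Relation.Binary.PropositionalEquality using (_≡_; refl; cong; subst)
open import Defs

_∈[_,_] : ∀ {m} → Fin m → Fin m → Fin m → Set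
v ∈[ i , j ] = i ≤ v × v ≤ j

_∈?[_,_] : ∀ {m} (v i j : Fin m) → Dec (v ∈[ i , j ])
v ∈?[ i , j ] with i ≤? v | v ≤? j
... | yes i≤v | yes v≤j = yes (i≤v , v≤j)
... | no  i≰v | _       = no (λ v∈ → i≰v (proj₁ v∈))
... | _       | no  v≰j = no (λ v∈ → v≰j (proj₂ v∈))

segment-convex : ∀ {m} {i j a b x : Fin m} →
  a ∈[ i , j ] → b ∈[ i , j ] → a ≤ x → x ≤ b → x ∈[ i , j ]
segment-convex (i≤a , _) (_ , b≤j) a≤x x≤b = ≤-trans i≤a a≤x , ≤-trans x≤b b≤j

segment-between : ∀ {m} {i j a b x y : Fin m} →
  x ∈[ i , j ] → ¬ a ∈[ i , j ] → ¬ b ∈[ i , j ] → a ≤ x → x ≤ b →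
  y ∈[ i , j ] → a ≤ y × y ≤ b
segment-between {i = i} {j} {a} {b} (i≤x , x≤j) a∉ b∉ a≤x x≤b (i≤y , y≤j) =
  ≤-trans (<⇒≤ a<i) i≤y , ≤-trans y≤j (<⇒≤ j<b)
  where
  a<i : toℕ a ℕ.< toℕ i
  a<i = ≰⇒> (λ i≤a → a∉ (i≤a , ≤-trans a≤x x≤j))
  j<b : toℕ j ℕ.< toℕ b
  j<b = ≰⇒> (λ b≤j → b∉ (≤-trans i≤x x≤b , b≤j))

strong-induction : ∀ {m ℓ} (Q : Fin (suc m) → Set ℓ) → Q Fin.zero →
  (∀ k → 1 ℕ.≤ toℕ k → (∀ l → l < k → Q l) → Q k) → ∀ k → Q k
strong-induction Q base step = All.wfRec <-wellFounded _ Q rec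
  where
  rec : ∀ k → (∀ {l} → l < k → Q l) → Q k
  rec Fin.zero    _  = base
  rec (Fin.suc k) ih = step (Fin.suc k) (s≤s z≤n) (λ l l<k → ih l<k)

record PinSplit {n} {M : Matching n} (P : EdgeOrder M) (k : Fin n) : Set where
  field
    x y     : Vertex n
    x-end   : Endpoint P k x
    y-end   : Endpoint P k y
    x-in    : InShadowBefore P k x
    y-out   : ¬ InShadowBefore P k y

pin-split : ∀ {n} {M : Matching n} {P : EdgeOrder M} → IsPinOrder P →
  ∀ k → 1 ℕ.≤ toℕ k → PinSplit P k
pin-split pin k 1≤k with pin k 1≤k
... | inj₁ (lo-in , hi-out) = record
  { x = _ ; y = _ ; x-end = inj₁ refl ; y-end = inj₂ refl ; x-in = lo-in ; y-out = hi-out }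
... | inj₂ (lo-out , hi-in) = record
  { x = _ ; y = _ ; x-end = inj₂ refl ; y-end = inj₁ refl ; x-in = hi-in ; y-out = lo-out }

module Propagation {n} {M : Matching n} {P : EdgeOrder M} (pin : IsPinOrder P)
                   {i j : Vertex n} (interval : IsInterval M i j) where

  Inside : Fin n → Set
  Inside k = low P k ∈[ i , j ]

  partner-inside : ∀ v → v ∈[ i , j ] → partner M v ∈[ i , j ]
  partner-inside v (i≤v , v≤j) = proj₂ interval v (partner M v) i≤v v≤j refl

  endpoint-inside : ∀ {k v} → Endpoint P k v → Inside k → v ∈[ i , j ]
  endpoint-inside (inj₁ refl) k-in = k-in
  endpoint-inside (inj₂ refl) k-in = partner-inside _ k-in

  inside-endpoint : ∀ {k v} → Endpoint P k v → v ∈[ i , j ] → Inside k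
  inside-endpoint (inj₁ refl) v-in = v-in
  inside-endpoint {k} (inj₂ refl) v-in =
    subst (_∈[ i , j ]) (involutive M (low P k)) (partner-inside _ v-in)

  shadow-inside : ∀ {k x} → (∀ l → l < k → Inside l) →
    InShadowBefore P k x → x ∈[ i , j ]
  shadow-inside earlier-in ((l , l<k , _ , a-end , a≤x) , (l′ , l′<k , _ , b-end , x≤b)) =
    segment-convex (endpoint-inside a-end (earlier-in l l<k))
                   (endpoint-inside b-end (earlier-in l′ l′<k)) a≤x x≤b

  shadow-captures : ∀ {k x y} → (∀ l → l < k → ¬ Inside l) →
    InShadowBefore P k x → x ∈[ i , j ] → y ∈[ i , j ] → InShadowBefore P k y
  shadow-captures earlier-out
    ((l , l<k , a , a-end , a≤x) , (l′ , l′<k , b , b-end , x≤b)) x-in y-in =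
    (l , l<k , a , a-end , proj₁ between) , (l′ , l′<k , b , b-end , proj₂ between)
    where
    between = segment-between x-in
      (λ a-in → earlier-out l l<k (inside-endpoint a-end a-in))
      (λ b-in → earlier-out l′ l′<k (inside-endpoint b-end b-in))
      a≤x x≤b y-in

  inside-step : ∀ k → 1 ℕ.≤ toℕ k → (∀ l → l < k → Inside l) → Inside k
  inside-step k 1≤k earlier-in = inside-endpoint x-end (shadow-inside earlier-in x-in)
    where open PinSplit (pin-split {P = P} pin k 1≤k)

  -- If all edges before pₖ are outside, so is pₖ: otherwise its shadow
  -- endpoint would drag its other endpoint into the shadow too.
  outside-step : ∀ k → 1 ℕ.≤ toℕ k → (∀ l → l < k → ¬ Inside l) → ¬ Inside k
  outside-step k 1≤k earlier-out k-in =
    y-out (shadow-captures earlier-out x-in (endpoint-inside x-end k-in)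
                                            (endpoint-inside y-end k-in))
    where open PinSplit (pin-split {P = P} pin k 1≤k)

module SameSide {m} {M : Matching (suc m)} {P : EdgeOrder M} (pin : IsPinOrder P)
                {i j : Vertex (suc m)} (interval : IsInterval M i j) where

  open Propagation {P = P} pin interval

  all-inside : Inside Fin.zero → ∀ v → v ∈[ i , j ]
  all-inside first-in v with covers P v
  ... | k , v-end = endpoint-inside v-end
    (strong-induction Inside first-in inside-step k)

  all-outside : ¬ Inside Fin.zero → ∀ v → ¬ v ∈[ i , j ]
  all-outside first-out v v-in with covers P v
  ... | k , v-end = strong-induction (λ k → ¬ Inside k) first-out outside-step k
                      (inside-endpoint v-end v-in)

last-element : ∀ {N} (j : Fin (suc N)) → fromℕ N ≤ j → suc (toℕ j) ≡ suc N
last-element {N} j last≤j =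
  cong suc (≤-antisym (subst (toℕ j ℕ.≤_) (toℕ-fromℕ N) (≤fromℕ j))
                      (subst (ℕ._≤ toℕ j) (toℕ-fromℕ N) last≤j))

proposition1p2 : ∀ (n : ℕ) (M : Matching n) → IsPinSequence M → Indecomposable M
proposition1p2 zero    M _         ()  _ _
proposition1p2 (suc m) M (P , pin) i j interval with low P Fin.zero ∈?[ i , j ]
... | yes first-in  =
  n≤0⇒n≡0 (proj₁ (all-inside first-in Fin.zero)) ,
  last-element j (proj₂ (all-inside first-in (fromℕ _)))
  where open SameSide {P = P} pin interval
... | no  first-out = ⊥-elim (all-outside first-out i (≤-refl , proj₁ interval))
  where open SameSide {P = P} pin interval
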